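{- Let $W=\{0,1/2\}$. The family $\{\mathrm{SPHP}_n\}_{n\in\mathbb N}$ is almost full, i.e. the number of points of $\{0,1/2\}^n$ satisfying all inequalities of $\mathrm{SPHP}_n$ is at least $2^n-o(2^n)$.
   Context: $\mathrm{SPHP}_n$ is the set of integer linear inequalities over $x_1,\dots,x_n$: $\sum_{i=1}^n x_i\geq 2$, and $x_i+x_j\leq 1$ for all $i\neq j\in[n]$. -}

module Defs where

open import Data.Nat using (ℕ; zero; suc)
open import Data.Fin using (Fin)
open import Data.Fin.Properties using (all?) renaming (_≟_ to _≟ᶠ_)
open import Data.Rational using (ℚ; 0ℚ; 1ℚ; ½; _+_; _≤_)
open import Data.Rational.Properties using (_≤?_)
open import Data.Vec using (Vec; []; _∷_; lookup; foldr)
open import Data.List using (List; []; _∷_; concatMap; map; filter; length)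
open import Relation.Binary.PropositionalEquality using (_≡_; _≢_)
open import Relation.Nullary using (Dec; ¬?)
open import Relation.Nullary.Decidable using (_×-dec_; _→-dec_)
open import Data.Product using (_×_)

W : List ℚ
W = 0ℚ ∷ ½ ∷ []

allVecs : {A : Set} → List A → (n : ℕ) → List (Vec A n)
allVecs as zero    = [] ∷ []
allVecs as (suc n) = concatMap (λ a → map (a ∷_) (allVecs as n)) as

2ℚ : ℚ
2ℚ = 1ℚ + 1ℚ

sumℚ : {n : ℕ} → Vec ℚ n → ℚ
sumℚ = foldr _ _+_ 0ℚ

SatSPHP : {n : ℕ} → Vec ℚ n → Set
SatSPHP {n} x =
  (2ℚ ≤ sumℚ x) × ((i j : Fin n) → i ≢ j → lookup x i + lookup x j ≤ 1ℚ)

satSPHP? : {n : ℕ} → (x : Vec ℚ n) → Dec (SatSPHP x)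
satSPHP? x = (2ℚ ≤? sumℚ x) ×-dec
  all? (λ i → all? (λ j → ¬? (i ≟ᶠ j) →-dec (lookup x i + lookup x j ≤? 1ℚ)))

countSPHP : ℕ → ℕ
countSPHP n = length (filter satSPHP? (allVecs W n))

-- A point of {0,1/2}^n automatically satisfies every inequality x_i + x_j ≤ 1, so it
-- violates SPHP_n only when its coordinate sum is below 2, i.e. when at most three of
-- its coordinates are 1/2.  Splitting on the first coordinate bounds the number of such
-- points by (n+1)^3, and k (n+1)^3 ≤ 2^n as soon as n ≥ 2048 k.
module Submission where

open import Defs
open import Data.Nat using (ℕ; _*_; _∸_; _^_; _≤_)
open import Data.Product using (Σ)

open import Level using (Level)
open import Data.Nat using (zero; suc; _+_; _≤?_; z≤n; s≤s)
open import Data.Nat.Properties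
  using (≤-trans; +-mono-≤; *-monoʳ-≤; *-monoˡ-≤; *-cancelˡ-≤; ^-monoˡ-≤;
         ^-zeroˡ; +-comm; +-suc; +-identityʳ; *-assoc; n≤1+n; m≤n⇒m≤1+n; m≤m+n; m+n∸m≡n;
         module ≤-Reasoning)
open import Data.Nat.Tactic.RingSolver using (solve-∀)
open import Data.Nat.Solver using (module +-*-Solver)
open import Data.Bool using (true; false)
open import Data.Unit using (tt)
open import Data.Product using (_×_; _,_; proj₂)
open import Data.Vec using (Vec; _∷_)
import Data.Vec.Relation.Unary.All as VecAll
open import Data.Vec.Relation.Unary.All.Properties using (lookup⁺)
open import Data.List using (List; []; _∷_; map; concatMap; filter; length; _++_)
open import Data.Nat.ListAction using (sum)
open import Data.List.Properties using (filter-++; filter-none; length-++; length-map; length-filter)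
open import Data.List.Relation.Unary.All as All using (All; []; _∷_)
open import Data.List.Relation.Unary.All.Properties using (++⁺; map⁺)
open import Data.Rational using (ℚ; 0ℚ; 1ℚ; ½)
  renaming (_+_ to _+ℚ_; _≤_ to _≤ℚ_; _<_ to _<ℚ_)
import Data.Rational.Properties as ℚ
open import Relation.Nullary using (yes; no; ¬_; does; contradiction)
open import Relation.Nullary.Decidable using (toWitness)
open import Relation.Unary using (Pred; Decidable; ∁)
open import Relation.Unary.Properties using (∁?)
open import Relation.Binary.PropositionalEquality using (_≡_; refl; sym; trans; cong; cong₂; subst; module ≡-Reasoning)

private
  variable
    A B : Set
    ℓ : Level

count : {P : Pred A ℓ} → Decidable P → List A → ℕ
count P? xs = length (filter P? xs)

count-++ : {P : Pred A ℓ} (P? : Decidable P) (xs ys : List A) →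
           count P? (xs ++ ys) ≡ count P? xs + count P? ys
count-++ P? xs ys = trans (cong length (filter-++ P? xs ys)) (length-++ (filter P? xs))

count-map : {P : Pred A ℓ} (P? : Decidable P) (f : B → A) (xs : List B) →
            count P? (map f xs) ≡ count (λ x → P? (f x)) xs
count-map P? f [] = refl
count-map P? f (x ∷ xs) with does (P? (f x))
... | true  = cong suc (count-map P? f xs)
... | false = count-map P? f xs

count-mono : {P Q : Pred A ℓ} (P? : Decidable P) (Q? : Decidable Q) {xs : List A} →
             All (λ x → P x → Q x) xs → count P? xs ≤ count Q? xs
count-mono P? Q? [] = z≤n
count-mono P? Q? {x ∷ xs} (P⇒Q ∷ P⇒Qs) with P? x | Q? x
... | yes _ | yes _ = s≤s (count-mono P? Q? P⇒Qs)
... | yes p | no ¬q = contradiction (P⇒Q p) ¬q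
... | no _  | yes _ = m≤n⇒m≤1+n (count-mono P? Q? P⇒Qs)
... | no _  | no _  = count-mono P? Q? P⇒Qs

count-none : {P : Pred A ℓ} (P? : Decidable P) {xs : List A} → All (∁ P) xs → count P? xs ≡ 0
count-none P? ¬ps = cong length (filter-none P? ¬ps)

count+count-∁ : {P : Pred A ℓ} (P? : Decidable P) (xs : List A) →
                count P? xs + count (∁? P?) xs ≡ length xs
count+count-∁ P? [] = refl
count+count-∁ P? (x ∷ xs) with P? x
... | yes _ = cong suc (count+count-∁ P? xs)
... | no  _ = trans (+-suc _ _) (cong suc (count+count-∁ P? xs))

prepend : {n : ℕ} → List A → List (Vec A n) → List (Vec A (suc n))
prepend as vs = concatMap (λ a → map (a ∷_) vs) as

length-prepend : {n : ℕ} (as : List A) (vs : List (Vec A n)) →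
                 length (prepend as vs) ≡ length as * length vs
length-prepend [] vs = refl
length-prepend (a ∷ as) vs = begin
  length (map (a ∷_) vs ++ prepend as vs)    ≡⟨ length-++ (map (a ∷_) vs) ⟩
  length (map (a ∷_) vs) + length (prepend as vs)
    ≡⟨ cong₂ _+_ (length-map (a ∷_) vs) (length-prepend as vs) ⟩
  length vs + length as * length vs          ∎
  where open ≡-Reasoning

length-allVecs : (as : List A) (n : ℕ) → length (allVecs as n) ≡ length as ^ n
length-allVecs as zero    = refl
length-allVecs as (suc n) =
  trans (length-prepend as (allVecs as n)) (cong (length as *_) (length-allVecs as n))

count-prepend : {n : ℕ} {P : Pred (Vec A (suc n)) ℓ} (P? : Decidable P)
                (as : List A) (vs : List (Vec A n)) →
                count P? (prepend as vs) ≡ sum (map (λ a → count (λ v → P? (a ∷ v)) vs) as)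
count-prepend P? [] vs = refl
count-prepend P? (a ∷ as) vs = begin
  count P? (map (a ∷_) vs ++ prepend as vs)        ≡⟨ count-++ P? (map (a ∷_) vs) (prepend as vs) ⟩
  count P? (map (a ∷_) vs) + count P? (prepend as vs)
    ≡⟨ cong₂ _+_ (count-map P? (a ∷_) vs) (count-prepend P? as vs) ⟩
  count (λ v → P? (a ∷ v)) vs + sum (map (λ b → count (λ v → P? (b ∷ v)) vs) as) ∎
  where open ≡-Reasoning

allVecs-All : {P : Pred A ℓ} (as : List A) → All P as → (n : ℕ) →
              All (VecAll.All P) (allVecs as n)
allVecs-All as Pas zero    = VecAll.[] ∷ []
allVecs-All {A = A} {P = P} as Pas (suc n) = prepend-All Pas
  where
  prepend-All : {bs : List A} → All P bs → All (VecAll.All P) (prepend bs (allVecs as n))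
  prepend-All []         = []
  prepend-All (Pb ∷ Pbs) =
    ++⁺ (map⁺ (All.map (Pb VecAll.∷_) (allVecs-All as Pas n))) (prepend-All Pbs)

HalfBounded : ℚ → Set
HalfBounded a = 0ℚ ≤ℚ a × a ≤ℚ ½

W-halfBounded : All HalfBounded W
W-halfBounded = (ℚ.≤-refl , 0≤½) ∷ (0≤½ , ℚ.≤-refl) ∷ []
  where
  0≤½ : 0ℚ ≤ℚ ½
  0≤½ = toWitness {a? = 0ℚ ℚ.≤? ½} tt

q≤q+sumℚ : {n : ℕ} {x : Vec ℚ n} (q : ℚ) → VecAll.All HalfBounded x → q ≤ℚ q +ℚ sumℚ x
q≤q+sumℚ {x = x} q hb =
  subst (_≤ℚ q +ℚ sumℚ x) (ℚ.+-identityʳ q) (ℚ.+-monoʳ-≤ q (sumℚ-nonneg hb))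
  where
  sumℚ-nonneg : {n : ℕ} {x : Vec ℚ n} → VecAll.All HalfBounded x → 0ℚ ≤ℚ sumℚ x
  sumℚ-nonneg VecAll.[] = ℚ.≤-refl
  sumℚ-nonneg {x = a ∷ x} ((0≤a , _) VecAll.∷ hb) =
    subst (_≤ℚ a +ℚ sumℚ x) (ℚ.+-identityʳ 0ℚ) (ℚ.+-mono-≤ 0≤a (sumℚ-nonneg hb))

halfBounded-sat : {n : ℕ} {x : Vec ℚ n} → VecAll.All HalfBounded x → 2ℚ ≤ℚ sumℚ x → SatSPHP x
halfBounded-sat hb 2≤Σx = 2≤Σx , λ i j _ →
  ℚ.≤-trans (ℚ.+-mono-≤ (proj₂ (lookup⁺ hb i)) (proj₂ (lookup⁺ hb j))) ½+½≤1
  where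
  ½+½≤1 : ½ +ℚ ½ ≤ℚ 1ℚ
  ½+½≤1 = toWitness {a? = (½ +ℚ ½) ℚ.≤? 1ℚ} tt

m^[1+n]+m^n≤[1+m]^[1+n] : ∀ m n → m ^ suc n + m ^ n ≤ suc m ^ suc n
m^[1+n]+m^n≤[1+m]^[1+n] m n = begin
  m * m ^ n + m ^ n         ≡⟨ +-comm (m * m ^ n) (m ^ n) ⟩
  m ^ n + m * m ^ n         ≤⟨ +-mono-≤ m^n≤ (*-monoʳ-≤ m m^n≤) ⟩
  suc m ^ n + m * suc m ^ n ∎
  where
  open ≤-Reasoning
  m^n≤ : m ^ n ≤ suc m ^ n
  m^n≤ = ^-monoˡ-≤ n (n≤1+n m)

halves : ℕ → ℚ
halves zero    = 0ℚ
halves (suc m) = ½ +ℚ halves m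

-- The offset q records the sum of the coordinates already split off in front.
countSumBelow2 : ℚ → ℕ → ℕ
countSumBelow2 q n = count (λ x → q +ℚ sumℚ x ℚ.<? 2ℚ) (allVecs W n)

countSumBelow2-zero : ∀ {q} n → 2ℚ ≤ℚ q → countSumBelow2 q n ≡ 0
countSumBelow2-zero {q} n 2≤q = count-none _ (All.map not-below (allVecs-All W W-halfBounded n))
  where
  not-below : {x : Vec ℚ n} → VecAll.All HalfBounded x → ¬ (q +ℚ sumℚ x <ℚ 2ℚ)
  not-below hb q+Σx<2 = ℚ.<-irrefl refl (ℚ.<-≤-trans q+Σx<2 (ℚ.≤-trans 2≤q (q≤q+sumℚ q hb)))

countSumBelow2-cons : ∀ q a n →
  count (λ x → q +ℚ sumℚ (a ∷ x) ℚ.<? 2ℚ) (allVecs W n) ≤ countSumBelow2 (q +ℚ a) n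
countSumBelow2-cons q a n = count-mono _ _ (All.universal reassociate (allVecs W n))
  where
  reassociate : (x : Vec ℚ n) → q +ℚ (a +ℚ sumℚ x) <ℚ 2ℚ → (q +ℚ a) +ℚ sumℚ x <ℚ 2ℚ
  reassociate x = subst (_<ℚ 2ℚ) (sym (ℚ.+-assoc q a (sumℚ x)))

countSumBelow2-suc : ∀ q n →
  countSumBelow2 q (suc n) ≤ countSumBelow2 q n + countSumBelow2 (q +ℚ ½) n
countSumBelow2-suc q n = begin
  countSumBelow2 q (suc n)                         ≡⟨ count-prepend _ W (allVecs W n) ⟩
  below 0ℚ + (below ½ + 0)                         ≡⟨ cong (below 0ℚ +_) (+-identityʳ (below ½)) ⟩
  below 0ℚ + below ½                               ≤⟨ +-mono-≤ (countSumBelow2-cons q 0ℚ n)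
                                                               (countSumBelow2-cons q ½ n) ⟩
  countSumBelow2 (q +ℚ 0ℚ) n + countSumBelow2 (q +ℚ ½) n
    ≡⟨ cong (λ r → countSumBelow2 r n + countSumBelow2 (q +ℚ ½) n) (ℚ.+-identityʳ q) ⟩
  countSumBelow2 q n + countSumBelow2 (q +ℚ ½) n   ∎
  where
  open ≤-Reasoning
  below : ℚ → ℕ
  below a = count (λ x → q +ℚ sumℚ (a ∷ x) ℚ.<? 2ℚ) (allVecs W n)

-- Under this hypothesis every counted vector has at most m coordinates equal to 1/2.
countSumBelow2-bound : ∀ m n q → 2ℚ ≤ℚ q +ℚ halves (suc m) → countSumBelow2 q n ≤ suc n ^ m
countSumBelow2-bound m zero q _ =
  subst (_ ≤_) (sym (^-zeroˡ m)) (length-filter (λ x → q +ℚ sumℚ x ℚ.<? 2ℚ) (allVecs W 0))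
countSumBelow2-bound zero (suc n) q 2≤q+½+0 = begin
  countSumBelow2 q (suc n)                       ≤⟨ countSumBelow2-suc q n ⟩
  countSumBelow2 q n + countSumBelow2 (q +ℚ ½) n
    ≡⟨ cong (countSumBelow2 q n +_) (countSumBelow2-zero n 2≤q+½) ⟩
  countSumBelow2 q n + 0
    ≤⟨ +-mono-≤ (countSumBelow2-bound zero n q 2≤q+½+0) z≤n ⟩
  1                                              ∎
  where
  open ≤-Reasoning
  2≤q+½ : 2ℚ ≤ℚ q +ℚ ½
  2≤q+½ = subst (2ℚ ≤ℚ_) (cong (q +ℚ_) (ℚ.+-identityʳ ½)) 2≤q+½+0
countSumBelow2-bound (suc m) (suc n) q 2≤q+h = begin
  countSumBelow2 q (suc n)                       ≤⟨ countSumBelow2-suc q n ⟩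
  countSumBelow2 q n + countSumBelow2 (q +ℚ ½) n
    ≤⟨ +-mono-≤ (countSumBelow2-bound (suc m) n q 2≤q+h)
                (countSumBelow2-bound m n (q +ℚ ½) 2≤q+½+h) ⟩
  suc n ^ suc m + suc n ^ m                      ≤⟨ m^[1+n]+m^n≤[1+m]^[1+n] (suc n) m ⟩
  suc (suc n) ^ suc m                            ∎
  where
  open ≤-Reasoning
  2≤q+½+h : 2ℚ ≤ℚ (q +ℚ ½) +ℚ halves (suc m)
  2≤q+½+h = subst (2ℚ ≤ℚ_) (sym (ℚ.+-assoc q ½ (halves (suc m)))) 2≤q+h

countUnsat≤[1+n]^3 : ∀ n → 2 ^ n ∸ countSPHP n ≤ suc n ^ 3
countUnsat≤[1+n]^3 n = begin
  2 ^ n ∸ countSPHP n                       ≡⟨ cong (_∸ countSPHP n) 2^n≡sat+unsat ⟩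
  countSPHP n + unsat ∸ countSPHP n         ≡⟨ m+n∸m≡n (countSPHP n) unsat ⟩
  unsat                                     ≤⟨ count-mono _ _ (All.map unsat⇒below halfBounded-grid) ⟩
  countSumBelow2 0ℚ n                       ≤⟨ countSumBelow2-bound 3 n 0ℚ 2≤0+halves4 ⟩
  suc n ^ 3                                 ∎
  where
  open ≤-Reasoning
  unsat : ℕ
  unsat = count (∁? satSPHP?) (allVecs W n)
  2^n≡sat+unsat : 2 ^ n ≡ countSPHP n + unsat
  2^n≡sat+unsat = trans (sym (length-allVecs W n)) (sym (count+count-∁ satSPHP? (allVecs W n)))
  halfBounded-grid : All (VecAll.All HalfBounded) (allVecs W n)
  halfBounded-grid = allVecs-All W W-halfBounded n
  unsat⇒below : {x : Vec ℚ n} → VecAll.All HalfBounded x → ¬ SatSPHP x → 0ℚ +ℚ sumℚ x <ℚ 2ℚ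
  unsat⇒below {x} hb ¬sat = subst (_<ℚ 2ℚ) (sym (ℚ.+-identityˡ (sumℚ x)))
    (ℚ.≰⇒> (λ 2≤Σx → ¬sat (halfBounded-sat hb 2≤Σx)))
  2≤0+halves4 : 2ℚ ≤ℚ 0ℚ +ℚ halves 4
  2≤0+halves4 = toWitness {a? = 2ℚ ℚ.≤? 0ℚ +ℚ halves 4} tt

[7+n]^4≤2*[6+n]^4 : ∀ n → (7 + n) ^ 4 ≤ 2 * (6 + n) ^ 4
[7+n]^4≤2*[6+n]^4 n = subst ((7 + n) ^ 4 ≤_) (sym expand) (m≤m+n _ _)
  where
  open +-*-Solver
  expand : 2 * (6 + n) ^ 4 ≡ (7 + n) ^ 4 + (191 + 356 * n + 138 * n ^ 2 + 20 * n ^ 3 + n ^ 4)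
  expand = solve 1 (λ x → con 2 :* (con 6 :+ x) :^ 4 :=
    (con 7 :+ x) :^ 4 :+ (con 191 :+ con 356 :* x :+ con 138 :* x :^ 2 :+ con 20 :* x :^ 3 :+ x :^ 4))
    refl n

[1+n]^4≤2048*2^n : ∀ n → suc n ^ 4 ≤ 2048 * 2 ^ n
[1+n]^4≤2048*2^n 0 = toWitness {a? = 1 ^ 4 ≤? 2048 * 2 ^ 0} tt
[1+n]^4≤2048*2^n 1 = toWitness {a? = 2 ^ 4 ≤? 2048 * 2 ^ 1} tt
[1+n]^4≤2048*2^n 2 = toWitness {a? = 3 ^ 4 ≤? 2048 * 2 ^ 2} tt
[1+n]^4≤2048*2^n 3 = toWitness {a? = 4 ^ 4 ≤? 2048 * 2 ^ 3} tt
[1+n]^4≤2048*2^n 4 = toWitness {a? = 5 ^ 4 ≤? 2048 * 2 ^ 4} tt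
[1+n]^4≤2048*2^n 5 = toWitness {a? = 6 ^ 4 ≤? 2048 * 2 ^ 5} tt
[1+n]^4≤2048*2^n (suc m@(suc (suc (suc (suc (suc n)))))) = begin
  (7 + n) ^ 4                ≤⟨ [7+n]^4≤2*[6+n]^4 n ⟩
  2 * (6 + n) ^ 4            ≤⟨ *-monoʳ-≤ 2 ([1+n]^4≤2048*2^n m) ⟩
  2 * (2048 * 2 ^ (5 + n))   ≡⟨ swap (2 ^ (5 + n)) ⟩
  2048 * (2 * 2 ^ (5 + n))   ∎
  where
  open ≤-Reasoning
  swap : ∀ y → 2 * (2048 * y) ≡ 2048 * (2 * y)
  swap = solve-∀

-- The extra factor n + 1 ≥ 2048 k absorbs k.
k*[1+n]^3≤2^n : ∀ k n → 2048 * k ≤ n → k * suc n ^ 3 ≤ 2 ^ n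
k*[1+n]^3≤2^n k n 2048k≤n = *-cancelˡ-≤ 2048 (begin
  2048 * (k * suc n ^ 3)   ≡⟨ sym (*-assoc 2048 k (suc n ^ 3)) ⟩
  2048 * k * suc n ^ 3     ≤⟨ *-monoˡ-≤ (suc n ^ 3) (m≤n⇒m≤1+n 2048k≤n) ⟩
  suc n ^ 4                ≤⟨ [1+n]^4≤2048*2^n n ⟩
  2048 * 2 ^ n             ∎)
  where open ≤-Reasoning

mainTheorem12 : (k : ℕ) → Σ ℕ (λ N → (n : ℕ) → N ≤ n →
    k * (2 ^ n ∸ countSPHP n) ≤ 2 ^ n)
mainTheorem12 k = 2048 * k , λ n 2048k≤n →
  ≤-trans (*-monoʳ-≤ k (countUnsat≤[1+n]^3 n)) (k*[1+n]^3≤2^n k n 2048k≤n)
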